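{- Let $X_3=\{0,1,2\}$ and let $\alpha,\beta$ be the maps $X_3^*\to X_3^*$ (viewed as endomorphisms of the ternary rooted tree $X_3^*$) defined recursively by $\alpha(\emptyset)=\beta(\emptyset)=\emptyset$ and, for every word $w$ over $X_3$, \[\alpha(0w)=0\alpha(w),\quad \alpha(1w)=1\alpha(w),\quad \alpha(2w)=1\beta(w),\] \[\beta(0w)=1\alpha(w),\quad \beta(1w)=1\beta(w),\quad \beta(2w)=0\beta(w).\] Let $S_L$ be the semigroup generated by $\alpha$ and $\beta$ under composition (with $\sigma\tau$ meaning: first apply $\tau$, then $\sigma$). Then $S_L$ has the semigroup presentation \[S_L=\langle \alpha,\beta \mid \alpha^2=\alpha,\ \alpha\beta=\beta\rangle.\] In other words, $S_L$ is the free cyclic semigroup generated by $\beta$ extended by a left identity element $\alpha$.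
   Context: These maps are the states of a finite transducer with input alphabet $\{0,1,2\}$ and output alphabet $\{0,1\}\subset\{0,1,2\}$; they preserve word length and the prefix relation. Maps act on the left. -}

module Defs where

open import Data.Fin using (Fin; zero; suc)
open import Data.List using (List; []; _∷_)
open import Data.List.NonEmpty using (List⁺; _∷_; [_]; _⁺++⁺_)
open import Function using (_∘_; id)

X₃ : Set
X₃ = Fin 3

Word : Set
Word = List X₃

𝟘 𝟙 𝟚 : X₃
𝟘 = zero
𝟙 = suc zero
𝟚 = suc (suc zero)

mutual
  α : Word → Word
  α []                      = []
  α (zero ∷ w)              = 𝟘 ∷ α w
  α (suc zero ∷ w)          = 𝟙 ∷ α w
  α (suc (suc zero) ∷ w)    = 𝟙 ∷ β w

  β : Word → Word
  β []                      = []
  β (zero ∷ w)              = 𝟙 ∷ α w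
  β (suc zero ∷ w)          = 𝟙 ∷ β w
  β (suc (suc zero) ∷ w)    = 𝟘 ∷ β w

data Gen : Set where
  a b : Gen

act : Gen → Word → Word
act a = α
act b = β

-- Elements of the free semigroup: nonempty words over Gen.
-- The word g₁ g₂ … gₙ evaluates to g₁ ∘ g₂ ∘ … ∘ gₙ (apply gₙ first).
evalL : List Gen → Word → Word
evalL []       = id
evalL (g ∷ gs) = act g ∘ evalL gs

eval : List⁺ Gen → Word → Word
eval (g ∷ gs) = act g ∘ evalL gs

_≗ₘ_ : (Word → Word) → (Word → Word) → Set
f ≗ₘ g = ∀ w → f w ≡ g w
  where open import Relation.Binary.PropositionalEquality using (_≡_)

data _~_ : List⁺ Gen → List⁺ Gen → Set where
  rel-aa : (a ∷ a ∷ []) ~ [ a ]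
  rel-ab : (a ∷ b ∷ []) ~ [ b ]
  ~-refl  : ∀ {u} → u ~ u
  ~-sym   : ∀ {u v} → u ~ v → v ~ u
  ~-trans : ∀ {u v w} → u ~ v → v ~ w → u ~ w
  ~-left  : ∀ {u v} (w : List⁺ Gen) → u ~ v → (w ⁺++⁺ u) ~ (w ⁺++⁺ v)
  ~-right : ∀ {u v} (w : List⁺ Gen) → u ~ v → (u ⁺++⁺ w) ~ (v ⁺++⁺ w)

{-# OPTIONS --safe #-}
-- The relations hold in S_L because α ∘ α = α and α ∘ β = β, which follow by a
-- simultaneous induction on the input word. Conversely, the relations rewrite
-- every word over {a, b} into a normal form bᵏe with e ∈ {a, b}, which acts as
-- βᵏ ∘ e. Distinct normal forms act differently: on 0ⁿ and on 2ⁿ (n > k) the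
-- output of bᵏe has exactly k + [e = b] and k + [e = a] letters 1 respectively,
-- and these two counts determine k and e.
module Submission where

open import Defs
open import Data.Fin using (zero; suc)
open import Data.List using ([]; _∷_; _++_; replicate)
open import Data.List.NonEmpty using (List⁺; _∷_; [_]; _⁺++⁺_; _∷⁺_)
open import Data.Nat using (ℕ; zero; suc; _+_; _≤_; _<_; s≤s)
open import Data.Nat.Properties using (+-identityʳ; +-suc; <⇒≤; m≤m+n; m≤n+m; m≤n⇒∃[o]m+o≡n)
open import Data.Product using (∃₂; _×_; _,_)
open import Function.Bundles using (_⇔_; mk⇔)
open import Function.Endo.Propositional Word using (_^_)
open import Relation.Binary.PropositionalEquality
  using (_≡_; refl; sym; trans; cong; module ≡-Reasoning)

open ≡-Reasoning

evalL-++ : ∀ xs ys w → evalL (xs ++ ys) w ≡ evalL xs (evalL ys w)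
evalL-++ []       ys w = refl
evalL-++ (g ∷ xs) ys w = cong (act g) (evalL-++ xs ys w)

eval-⁺++⁺ : ∀ u v w → eval (u ⁺++⁺ v) w ≡ eval u (eval v w)
eval-⁺++⁺ (g ∷ gs) v w = cong (act g) (evalL-++ gs _ w)

mutual
  α∘α≗α : ∀ w → α (α w) ≡ α w
  α∘α≗α []                   = refl
  α∘α≗α (zero ∷ w)           = cong (𝟘 ∷_) (α∘α≗α w)
  α∘α≗α (suc zero ∷ w)       = cong (𝟙 ∷_) (α∘α≗α w)
  α∘α≗α (suc (suc zero) ∷ w) = cong (𝟙 ∷_) (α∘β≗β w)

  α∘β≗β : ∀ w → α (β w) ≡ β w
  α∘β≗β []                   = refl
  α∘β≗β (zero ∷ w)           = cong (𝟙 ∷_) (α∘α≗α w)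
  α∘β≗β (suc zero ∷ w)       = cong (𝟙 ∷_) (α∘β≗β w)
  α∘β≗β (suc (suc zero) ∷ w) = cong (𝟘 ∷_) (α∘β≗β w)

~⇒≗ₘ : ∀ {u v} → u ~ v → eval u ≗ₘ eval v
~⇒≗ₘ rel-aa          w = α∘α≗α w
~⇒≗ₘ rel-ab          w = α∘β≗β w
~⇒≗ₘ ~-refl          w = refl
~⇒≗ₘ (~-sym p)       w = sym (~⇒≗ₘ p w)
~⇒≗ₘ (~-trans p q)   w = trans (~⇒≗ₘ p w) (~⇒≗ₘ q w)
~⇒≗ₘ (~-left {u} {v} x p) w = begin
  eval (x ⁺++⁺ u) w  ≡⟨ eval-⁺++⁺ x u w ⟩
  eval x (eval u w)  ≡⟨ cong (eval x) (~⇒≗ₘ p w) ⟩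
  eval x (eval v w)  ≡⟨ eval-⁺++⁺ x v w ⟨
  eval (x ⁺++⁺ v) w  ∎
~⇒≗ₘ (~-right {u} {v} x p) w = begin
  eval (u ⁺++⁺ x) w  ≡⟨ eval-⁺++⁺ u x w ⟩
  eval u (eval x w)  ≡⟨ ~⇒≗ₘ p (eval x w) ⟩
  eval v (eval x w)  ≡⟨ eval-⁺++⁺ v x w ⟨
  eval (v ⁺++⁺ x) w  ∎

infix 25 b^_∙_

b^_∙_ : ℕ → Gen → List⁺ Gen
b^ zero  ∙ e = [ e ]
b^ suc k ∙ e = b ∷⁺ b^ k ∙ e

a∷⁺u~u : ∀ u → (a ∷⁺ u) ~ u
a∷⁺u~u (g ∷ [])     = a∷[g]~[g] g
  where
  a∷[g]~[g] : ∀ g → (a ∷⁺ [ g ]) ~ [ g ]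
  a∷[g]~[g] a = rel-aa
  a∷[g]~[g] b = rel-ab
a∷⁺u~u (g ∷ h ∷ hs) = ~-right (h ∷ hs) (a∷⁺u~u [ g ])

~-normalForm : ∀ u → ∃₂ λ k e → u ~ b^ k ∙ e
~-normalForm (g ∷ gs) = go g gs
  where
  go : ∀ g gs → ∃₂ λ k e → (g ∷ gs) ~ b^ k ∙ e
  go g []       = 0 , g , ~-refl
  go a (h ∷ hs) with k , e , p ← go h hs = k , e , ~-trans (a∷⁺u~u (h ∷ hs)) p
  go b (h ∷ hs) with k , e , p ← go h hs = suc k , e , ~-left [ b ] p

eval-b^∙ : ∀ k e w → eval (b^ k ∙ e) w ≡ (β ^ k) (act e w)
eval-b^∙ zero    e w = refl
eval-b^∙ (suc k) e w = cong β (eval-b^∙ k e w)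

zeros twos : ℕ → Word
zeros n = replicate n 𝟘
twos  n = replicate n 𝟚

onesThenZeros : ℕ → ℕ → Word
onesThenZeros i m = replicate i 𝟙 ++ zeros m

countOnes : Word → ℕ
countOnes []             = 0
countOnes (suc zero ∷ w) = suc (countOnes w)
countOnes (_ ∷ w)        = countOnes w

countOnes-onesThenZeros : ∀ i m → countOnes (onesThenZeros i m) ≡ i
countOnes-onesThenZeros zero    zero    = refl
countOnes-onesThenZeros zero    (suc m) = countOnes-onesThenZeros zero m
countOnes-onesThenZeros (suc i) m       = cong suc (countOnes-onesThenZeros i m)

α-zeros : ∀ n → α (zeros n) ≡ zeros n
α-zeros zero    = refl
α-zeros (suc n) = cong (𝟘 ∷_) (α-zeros n)

β-twos : ∀ n → β (twos n) ≡ zeros n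
β-twos zero    = refl
β-twos (suc n) = cong (𝟘 ∷_) (β-twos n)

β-onesThenZeros : ∀ i m → β (onesThenZeros i (suc m)) ≡ onesThenZeros (suc i) m
β-onesThenZeros zero    m = cong (𝟙 ∷_) (α-zeros m)
β-onesThenZeros (suc i) m = cong (𝟙 ∷_) (β-onesThenZeros i m)

β^-onesThenZeros : ∀ k i m → (β ^ k) (onesThenZeros i (k + m)) ≡ onesThenZeros (i + k) m
β^-onesThenZeros zero    i m = cong (λ j → onesThenZeros j m) (sym (+-identityʳ i))
β^-onesThenZeros (suc k) i m = begin
  β ((β ^ k) (onesThenZeros i (suc (k + m))))  ≡⟨ cong (λ n → β ((β ^ k) (onesThenZeros i n))) (+-suc k m) ⟨
  β ((β ^ k) (onesThenZeros i (k + suc m)))    ≡⟨ cong β (β^-onesThenZeros k i (suc m)) ⟩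
  β (onesThenZeros (i + k) (suc m))            ≡⟨ β-onesThenZeros (i + k) m ⟩
  onesThenZeros (suc (i + k)) m                ≡⟨ cong (λ j → onesThenZeros j m) (+-suc i k) ⟨
  onesThenZeros (i + suc k) m                  ∎

countOnes-β^ : ∀ {k n} i → k ≤ n → countOnes ((β ^ k) (onesThenZeros i n)) ≡ i + k
countOnes-β^ {k} i k≤n with m , refl ← m≤n⇒∃[o]m+o≡n k≤n =
  trans (cong countOnes (β^-onesThenZeros k i m)) (countOnes-onesThenZeros (i + k) m)

onesOnZeros onesOnTwos : Gen → ℕ
onesOnZeros a = 0
onesOnZeros b = 1
onesOnTwos  a = 1
onesOnTwos  b = 0

countOnes-zeros : ∀ {k n} e → k < n → countOnes (eval (b^ k ∙ e) (zeros n)) ≡ onesOnZeros e + k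
countOnes-zeros {k} {n} e k<n rewrite eval-b^∙ k e (zeros n) = on e k<n
  where
  on : ∀ {n} e → k < n → countOnes ((β ^ k) (act e (zeros n))) ≡ onesOnZeros e + k
  on {n}     a k<n       rewrite α-zeros n = countOnes-β^ 0 (<⇒≤ k<n)
  on {suc n} b (s≤s k≤n) rewrite α-zeros n = countOnes-β^ 1 k≤n

countOnes-twos : ∀ {k n} e → k < n → countOnes (eval (b^ k ∙ e) (twos n)) ≡ onesOnTwos e + k
countOnes-twos {k} {n} e k<n rewrite eval-b^∙ k e (twos n) = on e k<n
  where
  on : ∀ {n} e → k < n → countOnes ((β ^ k) (act e (twos n))) ≡ onesOnTwos e + k
  on {suc n} a (s≤s k≤n) rewrite β-twos n = countOnes-β^ 1 k≤n
  on {n}     b k<n       rewrite β-twos n = countOnes-β^ 0 (<⇒≤ k<n)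

-- The absurd cases are the cyclic equations 2 + k' ≡ k' and 2 + k ≡ k.
onesCounts-injective : ∀ {k k'} e e' → onesOnZeros e + k ≡ onesOnZeros e' + k' →
                       onesOnTwos e + k ≡ onesOnTwos e' + k' → k ≡ k' × e ≡ e'
onesCounts-injective a a refl refl = refl , refl
onesCounts-injective b b refl refl = refl , refl
onesCounts-injective a b refl ()
onesCounts-injective b a refl ()

eval-b^∙-injective : ∀ k e k' e' → eval (b^ k ∙ e) ≗ₘ eval (b^ k' ∙ e') → k ≡ k' × e ≡ e'
eval-b^∙-injective k e k' e' same = onesCounts-injective e e' onZeros onTwos
  where
  n : ℕ
  n = suc (k + k')

  k<n : k < n
  k<n = s≤s (m≤m+n k k')

  k'<n : k' < n
  k'<n = s≤s (m≤n+m k' k)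

  onZeros : onesOnZeros e + k ≡ onesOnZeros e' + k'
  onZeros = begin
    onesOnZeros e + k                        ≡⟨ countOnes-zeros e k<n ⟨
    countOnes (eval (b^ k ∙ e) (zeros n))    ≡⟨ cong countOnes (same (zeros n)) ⟩
    countOnes (eval (b^ k' ∙ e') (zeros n))  ≡⟨ countOnes-zeros e' k'<n ⟩
    onesOnZeros e' + k'                      ∎

  onTwos : onesOnTwos e + k ≡ onesOnTwos e' + k'
  onTwos = begin
    onesOnTwos e + k                         ≡⟨ countOnes-twos e k<n ⟨
    countOnes (eval (b^ k ∙ e) (twos n))     ≡⟨ cong countOnes (same (twos n)) ⟩
    countOnes (eval (b^ k' ∙ e') (twos n))   ≡⟨ countOnes-twos e' k'<n ⟩
    onesOnTwos e' + k'                       ∎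

≗ₘ⇒~ : ∀ u v → eval u ≗ₘ eval v → u ~ v
≗ₘ⇒~ u v same
  with k , e , u~ ← ~-normalForm u | k' , e' , v~ ← ~-normalForm v
  with refl , refl ← eval-b^∙-injective k e k' e' (λ w → trans (sym (~⇒≗ₘ u~ w)) (trans (same w) (~⇒≗ₘ v~ w)))
  = ~-trans u~ (~-sym v~)

mainTheorem1 : (u v : List⁺ Gen) → (eval u ≗ₘ eval v) ⇔ (u ~ v)
mainTheorem1 u v = mk⇔ (≗ₘ⇒~ u v) ~⇒≗ₘ
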